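{- Let $1 \leq t \leq r_1 \leq \dots \leq r_k$ (with $k\geq 2$), and for each $i \in [k]$ let $\mathcal{F}_i = \binom{[n_i]}{r_i}$ with $n_i \geq (r_i-t)\,c(r_{k-1},r_k,t) + t$. Then $(\mathcal{F}_1, \dots, \mathcal{F}_k)$ has the extrastrong cross-$t$-star property.
   Context: $[n]=\{1,\dots,n\}$ and $\binom{[n]}{r}$ is the family of all $r$-element subsets of $[n]$. $c(r,s,t)=\max\{r\binom{s}{t},s\binom{r}{t}\}+1$ if $t\leq\min\{r,s\}$, and $1$ otherwise. Families $\mathcal{A}_1,\dots,\mathcal{A}_k$ are cross-$t$-intersecting if for all distinct $i,j$ each set of $\mathcal{A}_i$ shares at least $t$ elements with each set of $\mathcal{A}_j$; the tuple is below $(\mathcal{F}_1,\dots,\mathcal{F}_k)$ if $\mathcal{A}_i\subseteq\mathcal{F}_i$ for all $i$. $\mathcal{F}(T)=\{F\in\mathcal{F}:T\subseteq F\}$. $(\mathcal{F}_1,\dots,\mathcal{F}_k)$ has the extrastrong cross-$t$-star property if there is a $t$-set $T$ such that for every cross-$t$-intersecting tuple $(\mathcal{A}_1,\dots,\mathcal{A}_k)$ below it, $\prod_{i}|\mathcal{A}_i|\leq\prod_i|\mathcal{F}_i(T)|$, with equality only if there is a $t$-set $T'$ with $\mathcal{A}_i=\mathcal{F}_i(T')$ for all $i$. -}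

module Defs where

open import Data.Nat using (ℕ; zero; suc; _+_; _*_; _∸_; _≤_; _⊔_; _⊓_)
open import Data.Nat.Combinatorics using (_C_)
open import Data.Bool using (Bool; true; false; _∧_; _∨_; not; if_then_else_)
open import Data.Fin using (Fin; zero; suc)
open import Data.Fin.Subset using (Subset; ∣_∣)
open import Data.Vec using (Vec; []; _∷_)
open import Data.List using (List; []; _∷_; map; _++_)
open import Data.Nat.ListAction using (sum)
open import Data.Product using (Σ; _×_; _,_; ∃-syntax)
open import Relation.Binary.PropositionalEquality using (_≡_; _≢_)
open import Relation.Nullary using (Dec; yes; no)

-- A subset of [n] = {1,…,n} is a Subset n (position i of the vector ↔ element i+1).
-- A family of subsets of [n] is given by its characteristic function.
Family : ℕ → Set
Family n = Subset n → Bool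

allSubsets : (n : ℕ) → List (Subset n)
allSubsets zero = [] ∷ []
allSubsets (suc n) = map (true ∷_) (allSubsets n) ++ map (false ∷_) (allSubsets n)

card : {n : ℕ} → Family n → ℕ
card {n} A = sum (map (λ S → if A S then 1 else 0) (allSubsets n))

binomFam : (n r : ℕ) → Family n
binomFam n r S with ∣ S ∣ Data.Nat.≟ r
... | yes _ = true
... | no _ = false

-- |A ∩ B| for A ⊆ [m], B ⊆ [n] (both viewed as subsets of the positive integers)
interSize : {m n : ℕ} → Subset m → Subset n → ℕ
interSize [] _ = 0
interSize (_ ∷ _) [] = 0
interSize (a ∷ as) (b ∷ bs) = (if a ∧ b then 1 else 0) + interSize as bs

subsetB : {m n : ℕ} → Subset m → Subset n → Bool
subsetB [] _ = true
subsetB (a ∷ as) [] = not a ∧ subsetB as []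
subsetB (a ∷ as) (b ∷ bs) = (not a ∨ b) ∧ subsetB as bs

-- a finite set of positive integers: a subset of [m] for some m
FinSet : Set
FinSet = Σ ℕ Subset

size : FinSet → ℕ
size (_ , T) = ∣ T ∣

star : {n : ℕ} → Family n → FinSet → Family n
star F (_ , T) S = F S ∧ subsetB T S

prodFin : (k : ℕ) → (Fin k → ℕ) → ℕ
prodFin zero f = 1
prodFin (suc k) f = f zero * prodFin k (λ i → f (suc i))

cfun : ℕ → ℕ → ℕ → ℕ
cfun r s t with t Data.Nat.≤? (r ⊓ s)
... | yes _ = suc ((r * (s C t)) ⊔ (s * (r C t)))
... | no _ = 1

module _ {k : ℕ} (n : Fin k → ℕ) where

  Below : (A F : (i : Fin k) → Family (n i)) → Set
  Below A F = ∀ i S → A i S ≡ true → F i S ≡ true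

  CrossInt : ℕ → ((i : Fin k) → Family (n i)) → Set
  CrossInt t A = ∀ i j → i ≢ j → ∀ S S' → A i S ≡ true → A j S' ≡ true →
                 t ≤ interSize S S'

  ExtrastrongCrossStar : ℕ → ((i : Fin k) → Family (n i)) → Set
  ExtrastrongCrossStar t F =
    Σ FinSet λ T → size T ≡ t ×
      (∀ (A : (i : Fin k) → Family (n i)) → CrossInt t A → Below A F →
         (prodFin k (λ i → card (A i)) ≤ prodFin k (λ i → card (star (F i) T)))
         × (prodFin k (λ i → card (A i)) ≡ prodFin k (λ i → card (star (F i) T)) →
            Σ FinSet λ T' → size T' ≡ t × (∀ i S → A i S ≡ star (F i) T' S)))

-- Let A (r-sets of [n]) and B (s-sets of [m]) be nonempty and cross-t-intersecting,
-- and let a, b be the sizes of t-stars in [n] and [m]. Either A and B lie in a common t-star, or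
-- |A||B| < ab. Every member of A contains a t-subset of a fixed member of B, so |A| ≤ C(s,t) a.
-- If B is a star whose centre T misses a member A₁ of A, every member of B contains T and a point
-- of A₁ ∖ T, so |B| ≤ r C(m-t-1, s-t-1) ≤ r b / c, since m ≥ (s - t) c + t. If neither family is
-- a star, the same argument applied to the stars of the t-subsets of a member of the other family
-- gives |A| ≤ C(s,t) s a / c and |B| ≤ C(r,t) r b / c. As c exceeds r_i C(r_j, t) whenever i ≠ j,
-- multiplying the bounds for the pairs (i, i - 1 mod k) gives (∏ |A_i|)² ≤ (∏ a_i)². In the case
-- of equality every pair shares a star centre, and a family of full star size has only one centre.

module Submission where

open import Data.Bool using (Bool; true; false; _∧_; _∨_; not; if_then_else_)
open import Data.Bool.Properties using (∧-comm)
open import Data.Empty using (⊥; ⊥-elim)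
open import Data.Fin using (Fin; zero; suc; fromℕ; inject₁; toℕ)
import Data.Fin
open import Data.Fin.Properties using (toℕ-inject₁; ≤fromℕ)
open import Data.Fin.Subset using (Subset; ∣_∣; ⊤) renaming (⊥ to ∅)
open import Data.Fin.Subset.Properties using (∣p∣≤n; ∣⊥∣≡0; ∣⊤∣≡n)
open import Data.List using ([]; _∷_; map; _++_)
open import Data.List.Properties using (map-++; map-∘; map-cong)
open import Data.Nat
open import Data.Nat.Combinatorics using (_C_; nCk+nC[k+1]≡[n+1]C[k+1])
open import Data.Nat.Combinatorics.Specification using (k>n⇒nCk≡0)
open import Data.Nat.ListAction using (sum)
open import Data.Nat.ListAction.Properties using (sum-++)
open import Data.Nat.Properties
open import Data.Nat.Tactic.RingSolver using (solve-∀)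
open import Data.Product using (Σ; _×_; _,_; proj₁; proj₂)
open import Data.Sum using (_⊎_; inj₁; inj₂; [_,_]′; swap)
open import Data.Vec using ([]; _∷_)
open import Relation.Binary.PropositionalEquality
open import Relation.Nullary using (yes; no; contradiction)

open import Algebra.Properties.CommutativeSemigroup +-commutativeSemigroup using (interchange)
open import Algebra.Properties.CommutativeSemigroup *-commutativeSemigroup
  using () renaming (interchange to *-interchange)

open import Defs

-- Sums over all subsets of [n]

sumSubsets : (n : ℕ) → (Subset n → ℕ) → ℕ
sumSubsets n w = sum (map w (allSubsets n))

sumSubsets-zero : (w : Subset 0 → ℕ) → sumSubsets 0 w ≡ w []
sumSubsets-zero w = +-identityʳ (w [])

sumSubsets-suc : ∀ n (w : Subset (suc n) → ℕ) →
  sumSubsets (suc n) w ≡ sumSubsets n (λ S → w (true ∷ S)) + sumSubsets n (λ S → w (false ∷ S))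
sumSubsets-suc n w = begin
    sum (map w (map (true ∷_) L ++ map (false ∷_) L))
  ≡⟨ cong sum (map-++ w (map (true ∷_) L) (map (false ∷_) L)) ⟩
    sum (map w (map (true ∷_) L) ++ map w (map (false ∷_) L))
  ≡⟨ sum-++ (map w (map (true ∷_) L)) _ ⟩
    sum (map w (map (true ∷_) L)) + sum (map w (map (false ∷_) L))
  ≡⟨ cong₂ _+_ (cong sum (sym (map-∘ L))) (cong sum (sym (map-∘ L))) ⟩
    sumSubsets n (λ S → w (true ∷ S)) + sumSubsets n (λ S → w (false ∷ S)) ∎
  where open ≡-Reasoning
        L = allSubsets n

sumSubsets-cong : ∀ n {w v : Subset n → ℕ} → (∀ S → w S ≡ v S) → sumSubsets n w ≡ sumSubsets n v
sumSubsets-cong n w≗v = cong sum (map-cong w≗v (allSubsets n))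

sumSubsets-mono : ∀ n {w v : Subset n → ℕ} → (∀ S → w S ≤ v S) → sumSubsets n w ≤ sumSubsets n v
sumSubsets-mono n {w} {v} w≤v = go (allSubsets n)
  where
  go : ∀ Ss → sum (map w Ss) ≤ sum (map v Ss)
  go [] = z≤n
  go (S ∷ Ss) = +-mono-≤ (w≤v S) (go Ss)

sumSubsets-+ : ∀ n (w v : Subset n → ℕ) →
  sumSubsets n (λ S → w S + v S) ≡ sumSubsets n w + sumSubsets n v
sumSubsets-+ n w v = go (allSubsets n)
  where
  go : ∀ Ss → sum (map (λ S → w S + v S) Ss) ≡ sum (map w Ss) + sum (map v Ss)
  go [] = refl
  go (S ∷ Ss) = trans (cong (w S + v S +_) (go Ss)) (interchange (w S) (v S) _ _)

sumSubsets-*ˡ : ∀ n c (w : Subset n → ℕ) → sumSubsets n (λ S → c * w S) ≡ c * sumSubsets n w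
sumSubsets-*ˡ n c w = go (allSubsets n)
  where
  go : ∀ Ss → sum (map (λ S → c * w S) Ss) ≡ c * sum (map w Ss)
  go [] = sym (*-zeroʳ c)
  go (S ∷ Ss) = trans (cong (c * w S +_) (go Ss)) (sym (*-distribˡ-+ c (w S) _))

sumSubsets-witness : ∀ n (w : Subset n → ℕ) → 0 < sumSubsets n w → Σ (Subset n) λ S → 0 < w S
sumSubsets-witness n w = go (allSubsets n)
  where
  go : ∀ Ss → 0 < sum (map w Ss) → Σ (Subset n) λ S → 0 < w S
  go (S ∷ Ss) pos with w S in eq
  ... | suc _ = S , subst (0 <_) (sym eq) z<s
  ... | zero = go Ss pos

sumSubsets-strict : ∀ n {w v : Subset n → ℕ} → (∀ S → w S ≤ v S) → ∀ S → w S < v S →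
  sumSubsets n w < sumSubsets n v
sumSubsets-strict zero {w} {v} _ [] lt rewrite sumSubsets-zero w | sumSubsets-zero v = lt
sumSubsets-strict (suc n) {w} {v} w≤v (true ∷ S) lt rewrite sumSubsets-suc n w | sumSubsets-suc n v =
  +-mono-<-≤ (sumSubsets-strict n (λ S → w≤v (true ∷ S)) S lt)
             (sumSubsets-mono n (λ S → w≤v (false ∷ S)))
sumSubsets-strict (suc n) {w} {v} w≤v (false ∷ S) lt rewrite sumSubsets-suc n w | sumSubsets-suc n v =
  +-mono-≤-< (sumSubsets-mono n (λ S → w≤v (true ∷ S)))
             (sumSubsets-strict n (λ S → w≤v (false ∷ S)) S lt)

_⊆_ : ∀ {a b} → Subset a → Subset b → Set
T ⊆ S = subsetB T S ≡ true

⊆-∷⁻ : ∀ {a b} x y {T : Subset a} {S : Subset b} → (x ∷ T) ⊆ (y ∷ S) → T ⊆ S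
⊆-∷⁻ false _ h = h
⊆-∷⁻ true true h = h
⊆-∷⁻ true false ()

⊆[]⇒⊆ : ∀ {a b} (T : Subset a) → T ⊆ ([] {A = Bool}) → (S : Subset b) → T ⊆ S
⊆[]⇒⊆ [] _ S = refl
⊆[]⇒⊆ (false ∷ T) h [] = ⊆[]⇒⊆ T h []
⊆[]⇒⊆ (false ∷ T) h (_ ∷ S) = ⊆[]⇒⊆ T h S

⊆-trans : ∀ {a b c} (T : Subset a) (U : Subset b) (S : Subset c) → T ⊆ U → U ⊆ S → T ⊆ S
⊆-trans [] U S _ _ = refl
⊆-trans T@(_ ∷ _) [] S T⊆U _ = ⊆[]⇒⊆ T T⊆U S
⊆-trans (false ∷ T) (false ∷ U) [] T⊆U U⊆S = ⊆-trans T U [] T⊆U U⊆S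
⊆-trans (false ∷ T) (y ∷ U) (z ∷ S) T⊆U U⊆S = ⊆-trans T U S T⊆U (⊆-∷⁻ y z {U} {S} U⊆S)
⊆-trans (true ∷ T) (true ∷ U) (true ∷ S) T⊆U U⊆S = ⊆-trans T U S T⊆U U⊆S
⊆-trans (true ∷ T) (false ∷ U) _ () _
⊆-trans (true ∷ T) (true ∷ U) [] _ ()
⊆-trans (true ∷ T) (true ∷ U) (false ∷ S) _ ()
⊆-trans (false ∷ T) (true ∷ U) [] _ ()

∅⊆ : ∀ m {b} (X : Subset b) → ∅ {m} ⊆ X
∅⊆ zero X = refl
∅⊆ (suc m) [] = ∅⊆ m ([] {A = Bool})
∅⊆ (suc m) (_ ∷ X) = ∅⊆ m X

⊤⊆⊤ : ∀ {t n} → t ≤ n → ⊤ {t} ⊆ ⊤ {n}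
⊤⊆⊤ z≤n = refl
⊤⊆⊤ (s≤s t≤n) = ⊤⊆⊤ t≤n

∣∣-mono-⊆ : ∀ {m} (U S : Subset m) → U ⊆ S → ∣ U ∣ ≤ ∣ S ∣
∣∣-mono-⊆ [] [] _ = z≤n
∣∣-mono-⊆ (true ∷ U) (true ∷ S) h = s≤s (∣∣-mono-⊆ U S h)
∣∣-mono-⊆ (false ∷ U) (true ∷ S) h = m≤n⇒m≤1+n (∣∣-mono-⊆ U S h)
∣∣-mono-⊆ (false ∷ U) (false ∷ S) h = ∣∣-mono-⊆ U S h

⊆[]⇒∣∣≡0 : ∀ {a} (T : Subset a) → T ⊆ ([] {A = Bool}) → ∣ T ∣ ≡ 0
⊆[]⇒∣∣≡0 [] _ = refl
⊆[]⇒∣∣≡0 (false ∷ T) h = ⊆[]⇒∣∣≡0 T h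

interSize-comm : ∀ {a b} (S : Subset a) (S' : Subset b) → interSize S S' ≡ interSize S' S
interSize-comm [] [] = refl
interSize-comm [] (_ ∷ _) = refl
interSize-comm (_ ∷ _) [] = refl
interSize-comm (x ∷ S) (y ∷ S') =
  cong₂ _+_ (cong (λ b → if b then 1 else 0) (∧-comm x y)) (interSize-comm S S')

interSize≤∣∣ : ∀ {m} (T Y : Subset m) → interSize T Y ≤ ∣ T ∣
interSize≤∣∣ [] [] = z≤n
interSize≤∣∣ (true ∷ T) (true ∷ Y) = s≤s (interSize≤∣∣ T Y)
interSize≤∣∣ (true ∷ T) (false ∷ Y) = m≤n⇒m≤1+n (interSize≤∣∣ T Y)
interSize≤∣∣ (false ∷ T) (_ ∷ Y) = interSize≤∣∣ T Y

interSize<∣∣ : ∀ {m} (T Y : Subset m) → subsetB T Y ≡ false → interSize T Y < ∣ T ∣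
interSize<∣∣ (true ∷ T) (true ∷ Y) h = s≤s (interSize<∣∣ T Y h)
interSize<∣∣ (true ∷ T) (false ∷ Y) h = s≤s (interSize≤∣∣ T Y)
interSize<∣∣ (false ∷ T) (_ ∷ Y) h = interSize<∣∣ T Y h

interSize-⊆ : ∀ {a b} (T : Subset a) (S : Subset b) → T ⊆ S → interSize T S ≡ ∣ T ∣
interSize-⊆ [] _ _ = refl
interSize-⊆ T@(_ ∷ _) [] h = sym (⊆[]⇒∣∣≡0 T h)
interSize-⊆ (true ∷ T) (true ∷ S) h = cong suc (interSize-⊆ T S h)
interSize-⊆ (false ∷ T) (_ ∷ S) h = interSize-⊆ T S h

interSize-monoʳ : ∀ {m} (T U S : Subset m) → U ⊆ S → interSize T U ≤ interSize T S
interSize-monoʳ [] [] [] _ = z≤n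
interSize-monoʳ (true ∷ T) (true ∷ U) (true ∷ S) h = s≤s (interSize-monoʳ T U S h)
interSize-monoʳ (true ∷ T) (false ∷ U) (true ∷ S) h = m≤n⇒m≤1+n (interSize-monoʳ T U S h)
interSize-monoʳ (true ∷ T) (false ∷ U) (false ∷ S) h = interSize-monoʳ T U S h
interSize-monoʳ (false ∷ T) (true ∷ U) (true ∷ S) h = interSize-monoʳ T U S h
interSize-monoʳ (false ∷ T) (false ∷ U) (_ ∷ S) h = interSize-monoʳ T U S h

_∪_ : ∀ {m} → Subset m → Subset m → Subset m
[] ∪ [] = []
(x ∷ T) ∪ (y ∷ U) = (x ∨ y) ∷ (T ∪ U)

∪-⊆ : ∀ {m} (T U S : Subset m) → T ⊆ S → U ⊆ S → (T ∪ U) ⊆ S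
∪-⊆ [] [] [] _ _ = refl
∪-⊆ (true ∷ T) (y ∷ U) (true ∷ S) h h' = ∪-⊆ T U S h (⊆-∷⁻ y true {U} {S} h')
∪-⊆ (false ∷ T) (true ∷ U) (true ∷ S) h h' = ∪-⊆ T U S h h'
∪-⊆ (false ∷ T) (false ∷ U) (true ∷ S) h h' = ∪-⊆ T U S h h'
∪-⊆ (false ∷ T) (false ∷ U) (false ∷ S) h h' = ∪-⊆ T U S h h'

∣∪∣-disjoint : ∀ {m} (T U : Subset m) → interSize T U ≡ 0 → ∣ T ∪ U ∣ ≡ ∣ T ∣ + ∣ U ∣
∣∪∣-disjoint [] [] _ = refl
∣∪∣-disjoint (true ∷ T) (false ∷ U) h = cong suc (∣∪∣-disjoint T U h)
∣∪∣-disjoint (false ∷ T) (true ∷ U) h = trans (cong suc (∣∪∣-disjoint T U h)) (sym (+-suc _ _))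
∣∪∣-disjoint (false ∷ T) (false ∷ U) h = ∣∪∣-disjoint T U h

_∖_ : ∀ {m} → Subset m → Subset m → Subset m
[] ∖ [] = []
(y ∷ Y) ∖ (x ∷ T) = (y ∧ not x) ∷ (Y ∖ T)

∖-disjoint : ∀ {m} (Y T : Subset m) → interSize T (Y ∖ T) ≡ 0
∖-disjoint [] [] = refl
∖-disjoint (true ∷ Y) (true ∷ T) = ∖-disjoint Y T
∖-disjoint (true ∷ Y) (false ∷ T) = ∖-disjoint Y T
∖-disjoint (false ∷ Y) (true ∷ T) = ∖-disjoint Y T
∖-disjoint (false ∷ Y) (false ∷ T) = ∖-disjoint Y T

∣∖∣≤ : ∀ {m} (Y T : Subset m) → ∣ Y ∖ T ∣ ≤ ∣ Y ∣
∣∖∣≤ [] [] = z≤n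
∣∖∣≤ (true ∷ Y) (true ∷ T) = m≤n⇒m≤1+n (∣∖∣≤ Y T)
∣∖∣≤ (true ∷ Y) (false ∷ T) = s≤s (∣∖∣≤ Y T)
∣∖∣≤ (false ∷ Y) (_ ∷ T) = ∣∖∣≤ Y T

interSize-∖ : ∀ {m} (Y T S : Subset m) → interSize Y S ≤ interSize (Y ∖ T) S + interSize T Y
interSize-∖ [] [] [] = z≤n
interSize-∖ (true ∷ Y) (true ∷ T) (true ∷ S) =
  subst (suc (interSize Y S) ≤_) (sym (+-suc _ _)) (s≤s (interSize-∖ Y T S))
interSize-∖ (true ∷ Y) (true ∷ T) (false ∷ S) =
  subst (interSize Y S ≤_) (sym (+-suc _ _)) (m≤n⇒m≤1+n (interSize-∖ Y T S))
interSize-∖ (true ∷ Y) (false ∷ T) (true ∷ S) = s≤s (interSize-∖ Y T S)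
interSize-∖ (true ∷ Y) (false ∷ T) (false ∷ S) = interSize-∖ Y T S
interSize-∖ (false ∷ Y) (true ∷ T) (_ ∷ S) = interSize-∖ Y T S
interSize-∖ (false ∷ Y) (false ∷ T) (_ ∷ S) = interSize-∖ Y T S

∣∪∣-⊆∖ : ∀ {m} (T U Y : Subset m) → U ⊆ (Y ∖ T) → ∣ T ∪ U ∣ ≡ ∣ T ∣ + ∣ U ∣
∣∪∣-⊆∖ T U Y U⊆Y∖T = ∣∪∣-disjoint T U
  (n≤0⇒n≡0 (subst (interSize T U ≤_) (∖-disjoint Y T) (interSize-monoʳ T U (Y ∖ T) U⊆Y∖T)))

interSize-∖-pos : ∀ {m t} (Y T S : Subset m) → t ≤ interSize Y S → interSize T Y < t →
  1 ≤ interSize (Y ∖ T) S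
interSize-∖-pos {t = t} Y T S t≤Y∩S T∩Y<t with interSize (Y ∖ T) S in eq
... | suc _ = s≤s z≤n
... | zero = contradiction
  (≤-trans t≤Y∩S (subst (λ x → interSize Y S ≤ x + interSize T Y) eq (interSize-∖ Y T S)))
  (<⇒≱ T∩Y<t)

-- The families live on different ground sets [n_i]; resize truncates a set or pads it with
-- absent elements.
resize : ∀ {a} b → Subset a → Subset b
resize zero _ = []
resize (suc b) [] = false ∷ resize b []
resize (suc b) (x ∷ S) = x ∷ resize b S

∣resize∣≤ : ∀ {a} b (S : Subset a) → ∣ resize b S ∣ ≤ ∣ S ∣
∣resize∣≤ zero S = z≤n
∣resize∣≤ (suc b) [] = ∣resize∣≤ b ([] {A = Bool})
∣resize∣≤ (suc b) (true ∷ S) = s≤s (∣resize∣≤ b S)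
∣resize∣≤ (suc b) (false ∷ S) = ∣resize∣≤ b S

interSize-resizeˡ : ∀ {a b} (S : Subset a) (S' : Subset b) → interSize (resize b S) S' ≡ interSize S S'
interSize-resizeˡ [] [] = refl
interSize-resizeˡ (_ ∷ _) [] = refl
interSize-resizeˡ [] (_ ∷ S') = interSize-resizeˡ [] S'
interSize-resizeˡ (x ∷ S) (y ∷ S') = cong (_ +_) (interSize-resizeˡ S S')

⊆-resizeʳ : ∀ {m a} (T : Subset m) (S : Subset a) → subsetB T (resize m S) ≡ subsetB T S
⊆-resizeʳ [] S = refl
⊆-resizeʳ (true ∷ T) [] = refl
⊆-resizeʳ (false ∷ T) [] = ⊆-resizeʳ T ([] {A = Bool})
⊆-resizeʳ (x ∷ T) (y ∷ S) = cong ((not x ∨ y) ∧_) (⊆-resizeʳ T S)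

⊆⇒⊆-resize : ∀ {a b c} (T : Subset a) (S : Subset b) → T ⊆ S → (X : Subset c) →
  subsetB (resize b T) X ≡ subsetB T X
⊆⇒⊆-resize {b = b} [] _ _ X = ⊆[]⇒⊆ (resize b []) (⊆[]-resize b) X
  where
  ⊆[]-resize : ∀ b → resize b ([] {A = Bool}) ⊆ ([] {A = Bool})
  ⊆[]-resize zero = refl
  ⊆[]-resize (suc b) = ⊆[]-resize b
⊆⇒⊆-resize T@(_ ∷ _) [] T⊆[] X = sym (⊆[]⇒⊆ T T⊆[] X)
⊆⇒⊆-resize (x ∷ T) (y ∷ S) T⊆S [] =
  cong (not x ∧_) (⊆⇒⊆-resize T S (⊆-∷⁻ x y {T} {S} T⊆S) [])
⊆⇒⊆-resize (x ∷ T) (y ∷ S) T⊆S (z ∷ X) =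
  cong ((not x ∨ z) ∧_) (⊆⇒⊆-resize T S (⊆-∷⁻ x y {T} {S} T⊆S) X)

⊆⇒∣resize∣≡ : ∀ {a b} (T : Subset a) (S : Subset b) → T ⊆ S → ∣ resize b T ∣ ≡ ∣ T ∣
⊆⇒∣resize∣≡ {b = b} [] _ _ = ∣resize[]∣ b
  where
  ∣resize[]∣ : ∀ b → ∣ resize b ([] {A = Bool}) ∣ ≡ 0
  ∣resize[]∣ zero = refl
  ∣resize[]∣ (suc b) = ∣resize[]∣ b
⊆⇒∣resize∣≡ (false ∷ T) [] T⊆[] = sym (⊆[]⇒∣∣≡0 T T⊆[])
⊆⇒∣resize∣≡ (true ∷ T) (true ∷ S) T⊆S = cong suc (⊆⇒∣resize∣≡ T S T⊆S)
⊆⇒∣resize∣≡ (false ∷ T) (_ ∷ S) T⊆S = ⊆⇒∣resize∣≡ T S T⊆S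

-- Binomial coefficients

binom : ℕ → ℕ → ℕ
binom n zero = 1
binom zero (suc k) = 0
binom (suc n) (suc k) = binom n k + binom n (suc k)

binom≡C : ∀ n k → binom n k ≡ n C k
binom≡C n zero = refl
binom≡C zero (suc k) = sym (k>n⇒nCk≡0 {0} {suc k} z<s)
binom≡C (suc n) (suc k) =
  trans (cong₂ _+_ (binom≡C n k) (binom≡C n (suc k))) (nCk+nC[k+1]≡[n+1]C[k+1] n k)

binom-pos : ∀ n k → k ≤ n → 0 < binom n k
binom-pos n zero _ = z<s
binom-pos (suc n) (suc k) (s≤s k≤n) = ≤-trans (binom-pos n k k≤n) (m≤m+n _ _)

binom-pos-large : ∀ {n r t c} → 0 < c → (r ∸ t) * c + t ≤ n → 0 < binom (n ∸ t) (r ∸ t)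
binom-pos-large {n} {r} {t} {c} c>0 large = binom-pos (n ∸ t) (r ∸ t)
  (subst (_≤ n ∸ t) (m+n∸n≡m (r ∸ t) t)
    (∸-monoˡ-≤ t (≤-trans (+-monoˡ-≤ t (m≤m*n (r ∸ t) c {{>-nonZero c>0}})) large)))

binom-monoˡ : ∀ {n n'} k → n ≤ n' → binom n k ≤ binom n' k
binom-monoˡ zero _ = ≤-refl
binom-monoˡ (suc k) z≤n = z≤n
binom-monoˡ (suc k) (s≤s n≤n') = +-mono-≤ (binom-monoˡ k n≤n') (binom-monoˡ (suc k) n≤n')

binom-1 : ∀ n → binom n 1 ≡ n
binom-1 zero = refl
binom-1 (suc n) = cong suc (binom-1 n)

binom-absorption : ∀ n k → suc k * binom (suc n) (suc k) ≡ suc n * binom n k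
binom-absorption zero zero = refl
binom-absorption zero (suc k) = *-zeroʳ (suc (suc k))
binom-absorption (suc n) zero =
  cong suc (trans (+-identityʳ _) (trans (binom-1 (suc n)) (sym (*-identityʳ (suc n)))))
binom-absorption (suc n) (suc k) = begin
    suc (suc k) * (binom (suc n) (suc k) + binom (suc n) (suc (suc k)))
  ≡⟨ *-distribˡ-+ (suc (suc k)) (binom (suc n) (suc k)) _ ⟩
    binom (suc n) (suc k) + suc k * binom (suc n) (suc k) + suc (suc k) * binom (suc n) (suc (suc k))
  ≡⟨ cong₂ (λ x y → binom (suc n) (suc k) + x + y) (binom-absorption n k) (binom-absorption n (suc k)) ⟩
    binom (suc n) (suc k) + suc n * binom n k + suc n * binom n (suc k)
  ≡⟨ +-assoc (binom (suc n) (suc k)) _ _ ⟩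
    binom (suc n) (suc k) + (suc n * binom n k + suc n * binom n (suc k))
  ≡⟨ cong (binom (suc n) (suc k) +_) (sym (*-distribˡ-+ (suc n) (binom n k) _)) ⟩
    suc (suc n) * binom (suc n) (suc k) ∎
  where open ≡-Reasoning

c*binom≤binom-suc : ∀ n k c → suc k * c ≤ suc n → c * binom n k ≤ binom (suc n) (suc k)
c*binom≤binom-suc n k c kc≤n = *-cancelˡ-≤ (suc k) (begin
    suc k * (c * binom n k)   ≡⟨ sym (*-assoc (suc k) c _) ⟩
    suc k * c * binom n k     ≤⟨ *-monoˡ-≤ (binom n k) kc≤n ⟩
    suc n * binom n k         ≡⟨ sym (binom-absorption n k) ⟩
    suc k * binom (suc n) (suc k) ∎)
  where open ≤-Reasoning

c*binom≤binom-pred : ∀ m s t c → t < s → (s ∸ t) * c + t ≤ m →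
  c * binom (m ∸ suc t) (s ∸ suc t) ≤ binom (m ∸ t) (s ∸ t)
c*binom≤binom-pred m s t zero _ _ = z≤n
c*binom≤binom-pred m s t c@(suc _) t<s large = begin
  c * binom (m ∸ suc t) (s ∸ suc t)              ≤⟨ c*binom≤binom-suc (m ∸ suc t) (s ∸ suc t) c step ⟩
  binom (suc (m ∸ suc t)) (suc (s ∸ suc t))      ≡⟨ cong₂ binom (sym m∸t≡) (sym s∸t≡) ⟩
  binom (m ∸ t) (s ∸ t)                          ∎
  where
  open ≤-Reasoning
  s∸t≡ : s ∸ t ≡ suc (s ∸ suc t)
  s∸t≡ = +-∸-assoc 1 t<s
  [s∸t]c≤m∸t : (s ∸ t) * c ≤ m ∸ t
  [s∸t]c≤m∸t = subst (_≤ m ∸ t) (m+n∸n≡m _ t) (∸-monoˡ-≤ t large)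
  t<m : t < m
  t<m = ≤-trans (+-monoˡ-≤ t (subst (1 ≤_) (sym (cong (_* c) s∸t≡)) (s≤s z≤n))) large
  m∸t≡ : m ∸ t ≡ suc (m ∸ suc t)
  m∸t≡ = +-∸-assoc 1 t<m
  step : suc (s ∸ suc t) * c ≤ suc (m ∸ suc t)
  step = subst₂ (λ x y → x * c ≤ y) s∸t≡ m∸t≡ [s∸t]c≤m∸t

∧-true⁻ : ∀ {a b} → a ∧ b ≡ true → a ≡ true × b ≡ true
∧-true⁻ {true} {true} _ = refl , refl

∧-true⁺ : ∀ {a b} → a ≡ true → b ≡ true → a ∧ b ≡ true
∧-true⁺ refl refl = refl

indicator : ∀ {n} → Family n → Subset n → ℕ
indicator A S = if A S then 1 else 0

_⊆ᶠ_ : ∀ {n} → Family n → Family n → Set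
A ⊆ᶠ B = ∀ S → A S ≡ true → B S ≡ true

Uniform : ∀ {n} → ℕ → Family n → Set
Uniform r A = ∀ S → A S ≡ true → ∣ S ∣ ≡ r

_⊆⋂_ : ∀ {a n} → Subset a → Family n → Set
T ⊆⋂ A = ∀ S → A S ≡ true → T ⊆ S

CrossIntersecting : ∀ {n m} → ℕ → Family n → Family m → Set
CrossIntersecting t A B = ∀ S S' → A S ≡ true → B S' ≡ true → t ≤ interSize S S'

star-⊆ᶠ : ∀ {a n} (A : Family n) (T : Subset a) → star A (a , T) ⊆ᶠ A
star-⊆ᶠ A T S p = proj₁ (∧-true⁻ {A S} p)

⊆⋂star : ∀ {a n} (A : Family n) (T : Subset a) → T ⊆⋂ star A (a , T)
⊆⋂star A T S p = proj₂ (∧-true⁻ {A S} p)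

Uniform-⊆ᶠ : ∀ {n r} {A B : Family n} → A ⊆ᶠ B → Uniform r B → Uniform r A
Uniform-⊆ᶠ A⊆B uniform S S∈A = uniform S (A⊆B S S∈A)

flip-cross : ∀ {n m t} {A : Family n} {B : Family m} → CrossIntersecting t A B → CrossIntersecting t B A
flip-cross {t = t} cross S' S S'∈B S∈A = subst (t ≤_) (interSize-comm S S') (cross S S' S∈A S'∈B)

card-cong : ∀ {n} {A B : Family n} → (∀ S → A S ≡ B S) → card A ≡ card B
card-cong {n} A≗B = sumSubsets-cong n (λ S → cong (λ b → if b then 1 else 0) (A≗B S))

indicator-mono : ∀ {n} {A B : Family n} → A ⊆ᶠ B → ∀ S → indicator A S ≤ indicator B S
indicator-mono {A = A} A⊆B S with A S in eq
... | false = z≤n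
... | true rewrite A⊆B S eq = ≤-refl

card-suc : ∀ {n} (A : Family (suc n)) →
  card A ≡ card (λ S → A (true ∷ S)) + card (λ S → A (false ∷ S))
card-suc {n} A = sumSubsets-suc n (indicator A)

card-mono : ∀ {n} {A B : Family n} → A ⊆ᶠ B → card A ≤ card B
card-mono {n} A⊆B = sumSubsets-mono n (indicator-mono A⊆B)

card-∅ : ∀ {n} (A : Family n) → (∀ S → A S ≡ true → ⊥) → card A ≡ 0
card-∅ {n} A empty = go (allSubsets n)
  where
  go : ∀ Ss → sum (map (indicator A) Ss) ≡ 0
  go [] = refl
  go (S ∷ Ss) with A S in eq
  ... | true = ⊥-elim (empty S eq)
  ... | false = go Ss

card≡0⊎member : ∀ {n} (A : Family n) → card A ≡ 0 ⊎ Σ (Subset n) λ S → A S ≡ true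
card≡0⊎member {n} A with card A in eq
... | zero = inj₁ refl
... | suc _ with sumSubsets-witness n (indicator A) (subst (0 <_) (sym eq) z<s)
...   | S , _ with A S in S∈A
...     | true = inj₂ (S , S∈A)

⊆ᶠ∧card≥⇒≗ : ∀ {n} {A B : Family n} → A ⊆ᶠ B → card B ≤ card A → ∀ S → A S ≡ B S
⊆ᶠ∧card≥⇒≗ {n} {A} {B} A⊆B card≤ S with A S in eqA | B S in eqB
... | true | true = refl
... | false | false = refl
... | true | false with () ← trans (sym (A⊆B S eqA)) eqB
... | false | true = ⊥-elim (<⇒≱ (sumSubsets-strict n (indicator-mono A⊆B) S strict) card≤)
  where
  strict : indicator A S < indicator B S
  strict rewrite eqA | eqB = z<s

binomFam⇒∣∣≡ : ∀ {n r} (S : Subset n) → binomFam n r S ≡ true → ∣ S ∣ ≡ r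
binomFam⇒∣∣≡ {n} {r} S h with ∣ S ∣ ≟ r
... | yes e = e

∣∣≡⇒binomFam : ∀ {n r} (S : Subset n) → ∣ S ∣ ≡ r → binomFam n r S ≡ true
∣∣≡⇒binomFam {n} {r} S e with ∣ S ∣ ≟ r
... | yes _ = refl
... | no ne = ⊥-elim (ne e)

binomFam-cong : ∀ {n n' r r'} (S : Subset n) (S' : Subset n') →
  (∣ S ∣ ≡ r → ∣ S' ∣ ≡ r') → (∣ S' ∣ ≡ r' → ∣ S ∣ ≡ r) →
  binomFam n r S ≡ binomFam n' r' S'
binomFam-cong {r = r} {r'} S S' to from with ∣ S ∣ ≟ r | ∣ S' ∣ ≟ r'
... | yes _ | yes _ = refl
... | no _ | no _ = refl
... | yes e | no ne = ⊥-elim (ne (to e))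
... | no ne | yes e = ⊥-elim (ne (from e))

binomFam-true∷ : ∀ n r (S : Subset n) → binomFam (suc n) (suc r) (true ∷ S) ≡ binomFam n r S
binomFam-true∷ n r S = binomFam-cong (true ∷ S) S suc-injective (cong suc)

binomFam-false∷ : ∀ n r (S : Subset n) → binomFam (suc n) r (false ∷ S) ≡ binomFam n r S
binomFam-false∷ n r S = binomFam-cong (false ∷ S) S (λ e → e) (λ e → e)

-- The size is written ∣ U ∣ + k so that no truncated subtraction occurs.
card-⊇-binomFam : ∀ m (U : Subset m) k →
  card (star (binomFam m (∣ U ∣ + k)) (m , U)) ≡ binom (m ∸ ∣ U ∣) k
card-⊇-binomFam zero [] zero = refl
card-⊇-binomFam zero [] (suc k) = refl
card-⊇-binomFam (suc m) (true ∷ U) k = begin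
    card (star F (suc m , true ∷ U))
  ≡⟨ card-suc (star F (suc m , true ∷ U)) ⟩
    card (λ S → F (true ∷ S) ∧ subsetB U S) + card (λ S → F (false ∷ S) ∧ false)
  ≡⟨ cong₂ _+_ (card-cong (λ S → cong (_∧ subsetB U S) (binomFam-true∷ m _ S)))
               (card-∅ (λ S → F (false ∷ S) ∧ false)
                  (λ S h → contradiction (proj₂ (∧-true⁻ {F (false ∷ S)} h)) λ ())) ⟩
    card (star (binomFam m (∣ U ∣ + k)) (m , U)) + 0
  ≡⟨ trans (+-identityʳ _) (card-⊇-binomFam m U k) ⟩
    binom (m ∸ ∣ U ∣) k ∎
  where open ≡-Reasoning
        F = binomFam (suc m) (suc (∣ U ∣ + k))
card-⊇-binomFam (suc m) (false ∷ U) zero = begin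
    card (star F (suc m , false ∷ U))
  ≡⟨ card-suc (star F (suc m , false ∷ U)) ⟩
    card (λ S → F (true ∷ S) ∧ subsetB U S) + card (λ S → F (false ∷ S) ∧ subsetB U S)
  ≡⟨ cong₂ _+_ (card-∅ (λ S → F (true ∷ S) ∧ subsetB U S) tooSmall)
               (card-cong (λ S → cong (_∧ subsetB U S) (binomFam-false∷ m _ S))) ⟩
    card (star (binomFam m (∣ U ∣ + 0)) (m , U))
  ≡⟨ card-⊇-binomFam m U zero ⟩
    1 ∎
  where
  open ≡-Reasoning
  F = binomFam (suc m) (∣ U ∣ + 0)
  tooSmall : ∀ S → F (true ∷ S) ∧ subsetB U S ≡ true → ⊥
  tooSmall S h with ∧-true⁻ h
  ... | inF , U⊆S = <⇒≱ (≤-reflexive (trans (binomFam⇒∣∣≡ (true ∷ S) inF) (+-identityʳ _)))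
                        (∣∣-mono-⊆ U S U⊆S)
card-⊇-binomFam (suc m) (false ∷ U) (suc k) = begin
    card (star F (suc m , false ∷ U))
  ≡⟨ card-suc (star F (suc m , false ∷ U)) ⟩
    card (λ S → F (true ∷ S) ∧ subsetB U S) + card (λ S → F (false ∷ S) ∧ subsetB U S)
  ≡⟨ cong₂ _+_ (card-cong (λ S → cong (_∧ subsetB U S)
                  (trans (cong (λ r → binomFam (suc m) r (true ∷ S)) (+-suc ∣ U ∣ k)) (binomFam-true∷ m _ S))))
               (card-cong (λ S → cong (_∧ subsetB U S) (binomFam-false∷ m _ S))) ⟩
    card (star (binomFam m (∣ U ∣ + k)) (m , U)) + card (star (binomFam m (∣ U ∣ + suc k)) (m , U))
  ≡⟨ cong₂ _+_ (card-⊇-binomFam m U k) (card-⊇-binomFam m U (suc k)) ⟩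
    binom (suc (m ∸ ∣ U ∣)) (suc k)
  ≡⟨ cong (λ x → binom x (suc k)) (sym (+-∸-assoc 1 (∣p∣≤n U))) ⟩
    binom (suc m ∸ ∣ U ∣) (suc k) ∎
  where open ≡-Reasoning
        F = binomFam (suc m) (∣ U ∣ + suc k)

card-star-binomFam : ∀ {a n r t} (T : Subset a) (S₀ : Subset n) → T ⊆ S₀ → ∣ T ∣ ≡ t → t ≤ r →
  card (star (binomFam n r) (a , T)) ≡ binom (n ∸ t) (r ∸ t)
card-star-binomFam {a} {n} {r} {t} T S₀ T⊆S₀ ∣T∣≡t t≤r = begin
    card (star (binomFam n r) (a , T))
  ≡⟨ card-cong (λ S → cong (binomFam n r S ∧_) (sym (⊆⇒⊆-resize T S₀ T⊆S₀ S))) ⟩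
    card (star (binomFam n r) (n , U))
  ≡⟨ cong (λ x → card (star (binomFam n x) (n , U))) r≡ ⟩
    card (star (binomFam n (∣ U ∣ + (r ∸ t))) (n , U))
  ≡⟨ card-⊇-binomFam n U (r ∸ t) ⟩
    binom (n ∸ ∣ U ∣) (r ∸ t)
  ≡⟨ cong (λ u → binom (n ∸ u) (r ∸ t)) ∣U∣≡t ⟩
    binom (n ∸ t) (r ∸ t) ∎
  where
  open ≡-Reasoning
  U = resize n T
  ∣U∣≡t : ∣ U ∣ ≡ t
  ∣U∣≡t = trans (⊆⇒∣resize∣≡ T S₀ T⊆S₀) ∣T∣≡t
  r≡ : r ≡ ∣ U ∣ + (r ∸ t)
  r≡ = trans (sym (m+[n∸m]≡n t≤r)) (cong (_+ (r ∸ t)) (sym ∣U∣≡t))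

⊆⋂⇒card≤ : ∀ {a m s u} {A : Family m} (U : Subset a) → ∣ U ∣ ≡ u → u ≤ s →
  Uniform s A → U ⊆⋂ A → card A ≤ binom (m ∸ u) (s ∸ u)
⊆⋂⇒card≤ {m = m} {s} {u} {A} U ∣U∣≡u u≤s uniform U⊆⋂A with card≡0⊎member A
... | inj₁ empty rewrite empty = z≤n
... | inj₂ (S₀ , S₀∈A) = subst (λ u → card A ≤ binom (m ∸ u) (s ∸ u)) ∣U'∣≡u bound
  where
  U' = resize m U
  U'≗U : ∀ S → subsetB U' S ≡ subsetB U S
  U'≗U = ⊆⇒⊆-resize U _ (U⊆⋂A S₀ S₀∈A)
  ∣U'∣≡u : ∣ U' ∣ ≡ u
  ∣U'∣≡u = trans (⊆⇒∣resize∣≡ U _ (U⊆⋂A S₀ S₀∈A)) ∣U∣≡u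
  A⊆star : A ⊆ᶠ star (binomFam m (∣ U' ∣ + (s ∸ ∣ U' ∣))) (m , U')
  A⊆star S S∈A = ∧-true⁺
    (∣∣≡⇒binomFam S (trans (uniform S S∈A) (sym (m+[n∸m]≡n (subst (_≤ s) (sym ∣U'∣≡u) u≤s)))))
    (trans (U'≗U S) (U⊆⋂A S S∈A))
  bound : card A ≤ binom (m ∸ ∣ U' ∣) (s ∸ ∣ U' ∣)
  bound = ≤-trans (card-mono A⊆star) (≤-reflexive (card-⊇-binomFam m U' (s ∸ ∣ U' ∣)))

⊆⋂⇒card≡0 : ∀ {m s} {A : Family m} (U : Subset m) → s < ∣ U ∣ → Uniform s A → U ⊆⋂ A →
  card A ≡ 0
⊆⋂⇒card≡0 {A = A} U s<u uniform U⊆⋂A = card-∅ A λ S S∈A →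
  <⇒≱ s<u (subst (∣ U ∣ ≤_) (uniform S S∈A) (∣∣-mono-⊆ U S (U⊆⋂A S S∈A)))

⊆star∧card≡⇒≡star : ∀ {a n r t} {A : Family n} (T : Subset a) → ∣ T ∣ ≡ t → t ≤ r →
  A ⊆ᶠ binomFam n r → T ⊆⋂ A → card A ≡ binom (n ∸ t) (r ∸ t) →
  ∀ S → A S ≡ star (binomFam n r) (a , T) S
⊆star∧card≡⇒≡star {n = n} {r} {A = A} T ∣T∣≡t t≤r A⊆F T⊆⋂A card≡ = ⊆ᶠ∧card≥⇒≗
  (λ S S∈A → ∧-true⁺ (A⊆F S S∈A) (T⊆⋂A S S∈A))
  (subst (_ ≤_) (sym card≡)
    (⊆⋂⇒card≤ T ∣T∣≡t t≤r (Uniform-⊆ᶠ (star-⊆ᶠ F T) binomFam⇒∣∣≡) (⊆⋂star F T)))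
  where F = binomFam n r

-- Covering bounds

restrict : ∀ {m} → Subset m → (Subset m → ℕ) → Subset m → ℕ
restrict T w S = if subsetB T S then w S else 0

restrict-+ : ∀ {m} (T S : Subset m) (w v : Subset m → ℕ) →
  restrict T w S + restrict T v S ≡ restrict T (λ S → w S + v S) S
restrict-+ T S w v with subsetB T S
... | true = refl
... | false = refl

sumSubsets-≤-cover : ∀ m (w : Subset m → ℕ) (Y : Subset m) t K →
  (∀ S → 0 < w S → t ≤ interSize Y S) →
  (∀ T → T ⊆ Y → ∣ T ∣ ≡ t → sumSubsets m (restrict T w) ≤ K) →
  sumSubsets m w ≤ binom ∣ Y ∣ t * K
sumSubsets-≤-cover m w Y zero K _ bounded =
  subst (sumSubsets m w ≤_) (sym (+-identityʳ K))
    (subst (_≤ K) (sumSubsets-cong m (λ S → cong (λ b → if b then w S else 0) (∅⊆ m S)))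
      (bounded (∅ {m}) (∅⊆ m Y) (∣⊥∣≡0 m)))
sumSubsets-≤-cover zero w [] (suc t) K meets _ rewrite sumSubsets-zero w with w [] in eq
... | zero = z≤n
... | suc _ with () ← meets [] (subst (0 <_) (sym eq) z<s)
sumSubsets-≤-cover (suc m) w (true ∷ Y) (suc t) K meets bounded rewrite sumSubsets-suc m w =
  subst (sumSubsets m (λ S → w (true ∷ S)) + sumSubsets m (λ S → w (false ∷ S)) ≤_)
    (sym (*-distribʳ-+ K (binom ∣ Y ∣ t) (binom ∣ Y ∣ (suc t)))) (+-mono-≤
    (sumSubsets-≤-cover m (λ S → w (true ∷ S)) Y t K (λ S p → s≤s⁻¹ (meets (true ∷ S) p))
      (λ T T⊆Y ∣T∣≡t → ≤-trans (m≤m+n _ _)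
         (subst (_≤ K) (sumSubsets-suc m (restrict (true ∷ T) w)) (bounded (true ∷ T) T⊆Y (cong suc ∣T∣≡t)))))
    (sumSubsets-≤-cover m (λ S → w (false ∷ S)) Y (suc t) K (λ S p → meets (false ∷ S) p)
      (λ T T⊆Y ∣T∣≡t → ≤-trans (m≤n+m _ _)
         (subst (_≤ K) (sumSubsets-suc m (restrict (false ∷ T) w)) (bounded (false ∷ T) T⊆Y ∣T∣≡t)))))
sumSubsets-≤-cover (suc m) w (false ∷ Y) (suc t) K meets bounded
  rewrite sumSubsets-suc m w | sym (sumSubsets-+ m (λ S → w (true ∷ S)) (λ S → w (false ∷ S))) =
  sumSubsets-≤-cover m (λ S → w (true ∷ S) + w (false ∷ S)) Y (suc t) K
    (λ S p → [ meets (true ∷ S) , meets (false ∷ S) ]′ (m+n>0⇒m>0∨n>0 (w (true ∷ S)) p))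
    (λ T T⊆Y ∣T∣≡t → subst (_≤ K)
       (trans (sumSubsets-suc m (restrict (false ∷ T) w))
         (trans (sym (sumSubsets-+ m _ _))
           (sumSubsets-cong m (λ S → restrict-+ T S (λ S → w (true ∷ S)) (λ S → w (false ∷ S))))))
       (bounded (false ∷ T) T⊆Y ∣T∣≡t))
  where
  m+n>0⇒m>0∨n>0 : ∀ a {b} → 0 < a + b → 0 < a ⊎ 0 < b
  m+n>0⇒m>0∨n>0 zero p = inj₂ p
  m+n>0⇒m>0∨n>0 (suc a) _ = inj₁ z<s

c*card≤-cover : ∀ {m b} c (A : Family m) (Y : Subset b) t K →
  (∀ S → A S ≡ true → t ≤ interSize Y S) →
  (∀ (T : Subset m) → T ⊆ Y → ∣ T ∣ ≡ t → c * card (star A (m , T)) ≤ K) →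
  c * card A ≤ binom ∣ Y ∣ t * K
c*card≤-cover {m} {b} c A Y t K meets bounded = begin
  c * card A                   ≡⟨ sym (sumSubsets-*ˡ m c (indicator A)) ⟩
  sumSubsets m w               ≤⟨ sumSubsets-≤-cover m w Y' t K meets' bounded' ⟩
  binom (∣ Y' ∣) t * K          ≤⟨ *-monoˡ-≤ K (binom-monoˡ t (∣resize∣≤ m Y)) ⟩
  binom (∣ Y ∣) t * K           ∎
  where
  open ≤-Reasoning
  Y' = resize m Y
  w : Subset m → ℕ
  w S = c * indicator A S
  meets' : ∀ S → 0 < w S → t ≤ interSize Y' S
  meets' S pos with A S in eq
  ... | true = subst (t ≤_) (sym (interSize-resizeˡ Y S)) (meets S eq)
  ... | false = contradiction (subst (0 <_) (*-zeroʳ c) pos) (<-irrefl refl)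
  restrict-indicator : ∀ T S → restrict T w S ≡ c * indicator (star A (m , T)) S
  restrict-indicator T S with subsetB T S | A S
  ... | true | true = refl
  ... | true | false = refl
  ... | false | true = sym (*-zeroʳ c)
  ... | false | false = sym (*-zeroʳ c)
  bounded' : ∀ T → T ⊆ Y' → ∣ T ∣ ≡ t → sumSubsets m (restrict T w) ≤ K
  bounded' T T⊆Y' ∣T∣≡t = subst (_≤ K)
    (sym (trans (sumSubsets-cong m (restrict-indicator T)) (sumSubsets-*ˡ m c (indicator (star A (m , T))))))
    (bounded T (trans (sym (⊆-resizeʳ T Y)) T⊆Y') ∣T∣≡t)

c*card≤-⊇suc : ∀ {m s t} c {A : Family m} (U : Subset m) → ∣ U ∣ ≡ suc t → t ≤ s →
  (s ∸ t) * c + t ≤ m → Uniform s A → U ⊆⋂ A → c * card A ≤ binom (m ∸ t) (s ∸ t)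
c*card≤-⊇suc {m} {s} {t} c {A} U ∣U∣≡ t≤s large uniform U⊆⋂A with suc t ≤? s
... | no t≮s rewrite ⊆⋂⇒card≡0 U (subst (s <_) (sym ∣U∣≡) (≰⇒> t≮s)) uniform U⊆⋂A | *-zeroʳ c =
  z≤n
... | yes t<s = ≤-trans (*-monoʳ-≤ c (⊆⋂⇒card≤ U ∣U∣≡ t<s uniform U⊆⋂A))
                        (c*binom≤binom-pred m s t c t<s large)

-- Each member of B contains T and, meeting A₁ in t points while T ⊄ A₁, a point of A₁ ∖ T.
c*card≤-missing : ∀ {m s t a a'} c {B : Family m} (T : Subset a) (A₁ : Subset a') →
  ∣ T ∣ ≡ t → t ≤ s → (s ∸ t) * c + t ≤ m → Uniform s B → T ⊆⋂ B →
  subsetB T A₁ ≡ false → (∀ S → B S ≡ true → t ≤ interSize A₁ S) →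
  c * card B ≤ ∣ A₁ ∣ * binom (m ∸ t) (s ∸ t)
c*card≤-missing {m} {s} {t} c {B} T A₁ ∣T∣≡t t≤s large uniform T⊆⋂B T⊄A₁ meetsA₁
  with card≡0⊎member B
... | inj₁ empty rewrite empty | *-zeroʳ c = z≤n
... | inj₂ (S₀ , S₀∈B) = begin
  c * card B                  ≤⟨ c*card≤-cover c B X 1 _ meetsX starBound ⟩
  binom (∣ X ∣) 1 * b          ≡⟨ cong (_* b) (binom-1 ∣ X ∣) ⟩
  ∣ X ∣ * b                    ≤⟨ *-monoˡ-≤ b (≤-trans (∣∖∣≤ Y T') (∣resize∣≤ m A₁)) ⟩
  ∣ A₁ ∣ * b                   ∎
  where
  open ≤-Reasoning
  b = binom (m ∸ t) (s ∸ t)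
  T' = resize m T
  T'≗T : ∀ {c} (X : Subset c) → subsetB T' X ≡ subsetB T X
  T'≗T = ⊆⇒⊆-resize T _ (T⊆⋂B S₀ S₀∈B)
  ∣T'∣≡t : ∣ T' ∣ ≡ t
  ∣T'∣≡t = trans (⊆⇒∣resize∣≡ T _ (T⊆⋂B S₀ S₀∈B)) ∣T∣≡t
  Y = resize m A₁
  X = Y ∖ T'
  T'∩Y<t : interSize T' Y < t
  T'∩Y<t = subst (interSize T' Y <_) ∣T'∣≡t
    (interSize<∣∣ T' Y (trans (⊆-resizeʳ T' A₁) (trans (T'≗T A₁) T⊄A₁)))
  meetsX : ∀ S → B S ≡ true → 1 ≤ interSize X S
  meetsX S S∈B = interSize-∖-pos Y T' S (subst (t ≤_) (sym (interSize-resizeˡ A₁ S)) (meetsA₁ S S∈B)) T'∩Y<t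
  starBound : ∀ T₁ → T₁ ⊆ X → ∣ T₁ ∣ ≡ 1 → c * card (star B (m , T₁)) ≤ b
  starBound T₁ T₁⊆X ∣T₁∣≡1 = c*card≤-⊇suc c (T' ∪ T₁)
    (trans (∣∪∣-⊆∖ T' T₁ Y T₁⊆X) (trans (cong₂ _+_ ∣T'∣≡t ∣T₁∣≡1) (+-comm t 1))) t≤s large
    (Uniform-⊆ᶠ (star-⊆ᶠ B T₁) uniform)
    (λ S p → ∪-⊆ T' T₁ S (trans (T'≗T S) (T⊆⋂B S (star-⊆ᶠ B T₁ S p))) (⊆⋂star B T₁ S p))

c*card≤-meeting : ∀ {n r t b} c {A : Family n} (Y : Subset b) → t ≤ r → Uniform r A →
  (∀ S → A S ≡ true → t ≤ interSize Y S) →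
  c * card A ≤ binom ∣ Y ∣ t * (c * binom (n ∸ t) (r ∸ t))
c*card≤-meeting {n} {r} {t} c {A} Y t≤r uniform meets = c*card≤-cover c A Y t _ meets
  λ T _ ∣T∣≡t →
    *-monoʳ-≤ c (⊆⋂⇒card≤ T ∣T∣≡t t≤r (Uniform-⊆ᶠ (star-⊆ᶠ A T) uniform) (⊆⋂star A T))

-- A second centre T₂ ⊉ T₁ would bound c |A| by t |A| through c*card≤-missing.
centre-unique : ∀ {n r t c a a'} {A : Family n} (T₁ : Subset a) (T₂ : Subset a') →
  t < c → t ≤ r → (r ∸ t) * c + t ≤ n → Uniform r A → card A ≡ binom (n ∸ t) (r ∸ t) →
  ∣ T₁ ∣ ≡ t → ∣ T₂ ∣ ≡ t → T₁ ⊆⋂ A → T₂ ⊆⋂ A → T₁ ⊆ T₂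
centre-unique {n} {r} {t} {c} {A = A} T₁ T₂ t<c t≤r large uniform full
  ∣T₁∣≡t ∣T₂∣≡t T₁⊆⋂A T₂⊆⋂A
  with subsetB T₁ T₂ in T₁⊆?T₂
... | true = refl
... | false = contradiction (*-cancelʳ-≤ c t (card A) {{>-nonZero pos}} c*card≤t*card) (<⇒≱ t<c)
  where
  pos : 0 < card A
  pos = subst (0 <_) (sym full) (binom-pos-large {r = r} {t} (≤-<-trans z≤n t<c) large)
  c*card≤t*card : c * card A ≤ t * card A
  c*card≤t*card = subst₂ (λ u v → c * card A ≤ u * v) ∣T₂∣≡t (sym full)
    (c*card≤-missing c T₁ T₂ ∣T₁∣≡t t≤r large uniform T₁⊆⋂A T₁⊆?T₂
      (λ S S∈A → ≤-reflexive (trans (sym ∣T₂∣≡t) (sym (interSize-⊆ T₂ S (T₂⊆⋂A S S∈A))))))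

∀-or-counterexample : ∀ n {P Q : Subset n → Set} → (∀ S → P S ⊎ Q S) →
  (∀ S → P S) ⊎ Σ (Subset n) Q
∀-or-counterexample zero decide with decide []
... | inj₁ p = inj₁ λ { [] → p }
... | inj₂ q = inj₂ ([] , q)
∀-or-counterexample (suc n) decide
  with ∀-or-counterexample n (λ S → decide (true ∷ S)) | ∀-or-counterexample n (λ S → decide (false ∷ S))
... | inj₂ (S , q) | _ = inj₂ (true ∷ S , q)
... | inj₁ _ | inj₂ (S , q) = inj₂ (false ∷ S , q)
... | inj₁ p | inj₁ p' = inj₁ λ { (true ∷ S) → p S ; (false ∷ S) → p' S }

Missing : ∀ {a n} → Family n → Subset a → Set
Missing {n = n} A T = Σ (Subset n) λ S → A S ≡ true × subsetB T S ≡ false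

⊆⋂⊎missing : ∀ {a n} (A : Family n) (T : Subset a) → T ⊆⋂ A ⊎ Missing A T
⊆⋂⊎missing {n = n} A T = ∀-or-counterexample n decide
  where
  decide : ∀ S → (A S ≡ true → T ⊆ S) ⊎ (A S ≡ true × subsetB T S ≡ false)
  decide S with A S | subsetB T S
  ... | true | false = inj₂ (refl , refl)
  ... | true | true = inj₁ λ _ → refl
  ... | false | _ = inj₁ λ ()

IsStar : ∀ {n} → ℕ → Family n → Set
IsStar {n} t A = Σ (Subset n) λ T → ∣ T ∣ ≡ t × T ⊆⋂ A

NonStar : ∀ {n} → ℕ → Family n → Set
NonStar {n} t A = ∀ (T : Subset n) → ∣ T ∣ ≡ t → Missing A T

star⊎nonStar : ∀ {n} t (A : Family n) → IsStar t A ⊎ NonStar t A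
star⊎nonStar {n} t A = swap (∀-or-counterexample n decide)
  where
  decide : ∀ T → (∣ T ∣ ≡ t → Missing A T) ⊎ (∣ T ∣ ≡ t × T ⊆⋂ A)
  decide T with ∣ T ∣ ≟ t
  ... | no ∣T∣≢t = inj₁ λ ∣T∣≡t → contradiction ∣T∣≡t ∣T∣≢t
  ... | yes ∣T∣≡t with ⊆⋂⊎missing A T
  ...   | inj₁ T⊆⋂A = inj₂ (∣T∣≡t , T⊆⋂A)
  ...   | inj₂ missing = inj₁ λ _ → missing

c*card≤-meeting-nonStar : ∀ {n m r s t} c {A : Family n} {B : Family m} →
  t ≤ r → (r ∸ t) * c + t ≤ n → Uniform r A → Uniform s B → NonStar t B → CrossIntersecting t B A →
  (B₀ : Subset m) → B B₀ ≡ true →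
  c * card A ≤ binom s t * s * binom (n ∸ t) (r ∸ t)
c*card≤-meeting-nonStar {n} {m} {r} {s} {t} c {A} {B} t≤r large uniformA uniformB nonStar cross B₀ B₀∈B =
  ≤-trans (subst (λ x → c * card A ≤ binom x t * _) (uniformB B₀ B₀∈B)
            (c*card≤-cover c A B₀ t _ (λ S → cross B₀ S B₀∈B) starBound))
          (≤-reflexive (sym (*-assoc (binom s t) s _)))
  where
  starBound : ∀ T → T ⊆ B₀ → ∣ T ∣ ≡ t → c * card (star A (n , T)) ≤ s * binom (n ∸ t) (r ∸ t)
  starBound T T⊆B₀ ∣T∣≡t with nonStar (resize m T) (trans (⊆⇒∣resize∣≡ T B₀ T⊆B₀) ∣T∣≡t)
  ... | B₁ , B₁∈B , T'⊄B₁ = subst (λ x → c * card (star A (n , T)) ≤ x * _) (uniformB B₁ B₁∈B)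
    (c*card≤-missing c T B₁ ∣T∣≡t t≤r large (Uniform-⊆ᶠ (star-⊆ᶠ A T) uniformA) (⊆⋂star A T)
      (trans (sym (⊆⇒⊆-resize T B₀ T⊆B₀ B₁)) T'⊄B₁) (λ S p → cross B₁ S B₁∈B (star-⊆ᶠ A T S p)))

*<*-from-scaled-bounds : ∀ {X Y a b c p q} → c * X ≤ p * a → c * Y ≤ q * b → p * q < c * c →
  0 < a → 0 < b → X * Y < a * b
*<*-from-scaled-bounds {X} {Y} {a} {b} {c} {p} {q} cX≤pa cY≤qb pq<cc a>0 b>0 =
  *-cancelˡ-< (c * c) (X * Y) (a * b) (begin-strict
    c * c * (X * Y)     ≡⟨ *-interchange c c X Y ⟩
    c * X * (c * Y)     ≤⟨ *-mono-≤ cX≤pa cY≤qb ⟩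
    p * a * (q * b)     ≡⟨ *-interchange p a q b ⟩
    p * q * (a * b)     <⟨ *-monoˡ-< (a * b) {{>-nonZero (*-mono-< a>0 b>0)}} pq<cc ⟩
    c * c * (a * b)     ∎)
  where open ≤-Reasoning

CommonCentre : ∀ {n m} → ℕ → Family n → Family m → Set
CommonCentre t A B = Σ FinSet λ T → size T ≡ t × proj₂ T ⊆⋂ A × proj₂ T ⊆⋂ B

star-missing⇒< : ∀ {n m r s t c} {A : Family n} {B : Family m} →
  Uniform r A → Uniform s B → CrossIntersecting t A B → t ≤ r → t ≤ s →
  (r ∸ t) * c + t ≤ n → (s ∸ t) * c + t ≤ m → r * binom s t < c →
  (T : Subset m) → ∣ T ∣ ≡ t → T ⊆⋂ B → Missing A T → (B₀ : Subset m) → B B₀ ≡ true →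
  card A * card B < binom (n ∸ t) (r ∸ t) * binom (m ∸ t) (s ∸ t)
star-missing⇒< {n} {m} {r} {s} {t} {c} {A} {B} uniformA uniformB cross t≤r t≤s largeA largeB rC<c
  T ∣T∣≡t T⊆⋂B (A₁ , A₁∈A , T⊄A₁) B₀ B₀∈B =
  *<*-from-scaled-bounds {card A} {card B} {c = c} {p = binom s t * c} {q = r} boundA boundB coefficients
    (binom-pos-large {r = r} {t} c>0 largeA) (binom-pos-large {r = s} {t} c>0 largeB)
  where
  c>0 = ≤-<-trans z≤n rC<c
  boundA : c * card A ≤ binom s t * c * binom (n ∸ t) (r ∸ t)
  boundA = ≤-trans
    (subst (λ x → c * card A ≤ binom x t * _) (uniformB B₀ B₀∈B)
      (c*card≤-meeting c B₀ t≤r uniformA (λ S S∈A → flip-cross cross B₀ S B₀∈B S∈A)))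
    (≤-reflexive (sym (*-assoc (binom s t) c _)))
  boundB : c * card B ≤ r * binom (m ∸ t) (s ∸ t)
  boundB = subst (λ x → c * card B ≤ x * _) (uniformA A₁ A₁∈A)
    (c*card≤-missing c T A₁ ∣T∣≡t t≤s largeB uniformB T⊆⋂B T⊄A₁
      (λ S S∈B → cross A₁ S A₁∈A S∈B))
  coefficients : binom s t * c * r < c * c
  coefficients = subst (_< c * c) (rearrange c r (binom s t)) (*-monoʳ-< c {{>-nonZero c>0}} rC<c)
    where rearrange : ∀ c r k → c * (r * k) ≡ k * c * r
          rearrange = solve-∀

pair-bound : ∀ {n m r s t c} {A : Family n} {B : Family m} →
  Uniform r A → Uniform s B → CrossIntersecting t A B → t ≤ r → t ≤ s →
  (r ∸ t) * c + t ≤ n → (s ∸ t) * c + t ≤ m → r * binom s t < c → s * binom r t < c →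
  (A₀ : Subset n) → A A₀ ≡ true → (B₀ : Subset m) → B B₀ ≡ true →
  card A * card B < binom (n ∸ t) (r ∸ t) * binom (m ∸ t) (s ∸ t) ⊎ CommonCentre t A B
pair-bound {n} {m} {r} {s} {t} {c} {A} {B}
  uniformA uniformB cross t≤r t≤s largeA largeB rC<c sC<c A₀ A₀∈A B₀ B₀∈B =
  cases (star⊎nonStar t B) (star⊎nonStar t A)
  where
  a = binom (n ∸ t) (r ∸ t)
  b = binom (m ∸ t) (s ∸ t)
  c>0 = ≤-<-trans z≤n rC<c
  cases : IsStar t B ⊎ NonStar t B → IsStar t A ⊎ NonStar t A → card A * card B < a * b ⊎ CommonCentre t A B
  cases (inj₁ (T , ∣T∣≡t , T⊆⋂B)) _ with ⊆⋂⊎missing A T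
  ... | inj₁ T⊆⋂A = inj₂ ((m , T) , ∣T∣≡t , T⊆⋂A , T⊆⋂B)
  ... | inj₂ missing = inj₁
    (star-missing⇒< uniformA uniformB cross t≤r t≤s largeA largeB rC<c T ∣T∣≡t T⊆⋂B missing B₀ B₀∈B)
  cases (inj₂ _) (inj₁ (T , ∣T∣≡t , T⊆⋂A)) with ⊆⋂⊎missing B T
  ... | inj₁ T⊆⋂B = inj₂ ((n , T) , ∣T∣≡t , T⊆⋂A , T⊆⋂B)
  ... | inj₂ missing = inj₁ (subst₂ _<_ (*-comm (card B) (card A)) (*-comm b a)
    (star-missing⇒< uniformB uniformA (flip-cross cross) t≤s t≤r largeB largeA sC<c
      T ∣T∣≡t T⊆⋂A missing A₀ A₀∈A))
  cases (inj₂ nonStarB) (inj₂ nonStarA) = inj₁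
    (*<*-from-scaled-bounds {card A} {card B} {c = c} {p = binom s t * s} {q = binom r t * r}
      (c*card≤-meeting-nonStar c t≤r largeA uniformA uniformB nonStarB (flip-cross cross) B₀ B₀∈B)
      (c*card≤-meeting-nonStar c t≤s largeB uniformB uniformA nonStarA cross A₀ A₀∈A)
      coefficients (binom-pos-large {r = r} {t} c>0 largeA) (binom-pos-large {r = s} {t} c>0 largeB))
    where
    coefficients : binom s t * s * (binom r t * r) < c * c
    coefficients = subst (_< c * c) (rearrange s r (binom r t) (binom s t)) (*-mono-< sC<c rC<c)
      where rearrange : ∀ s r k l → s * k * (r * l) ≡ l * s * (k * r)
            rearrange = solve-∀

-- Products over Fin k

prodFin-cong : ∀ k {f g : Fin k → ℕ} → (∀ i → f i ≡ g i) → prodFin k f ≡ prodFin k g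
prodFin-cong zero _ = refl
prodFin-cong (suc k) f≗g = cong₂ _*_ (f≗g zero) (prodFin-cong k (λ i → f≗g (suc i)))

prodFin-mono : ∀ k {f g : Fin k → ℕ} → (∀ i → f i ≤ g i) → prodFin k f ≤ prodFin k g
prodFin-mono zero _ = ≤-refl
prodFin-mono (suc k) f≤g = *-mono-≤ (f≤g zero) (prodFin-mono k (λ i → f≤g (suc i)))

prodFin-pos : ∀ k {f : Fin k → ℕ} → (∀ i → 0 < f i) → 0 < prodFin k f
prodFin-pos zero _ = z<s
prodFin-pos (suc k) pos = *-mono-< (pos zero) (prodFin-pos k (λ i → pos (suc i)))

prodFin-zero : ∀ k {f : Fin k → ℕ} i → f i ≡ 0 → prodFin k f ≡ 0
prodFin-zero (suc k) {f} zero fi≡0 = cong (_* prodFin k (λ i → f (suc i))) fi≡0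
prodFin-zero (suc k) {f} (suc i) fi≡0 = trans (cong (f zero *_) (prodFin-zero k i fi≡0)) (*-zeroʳ (f zero))

prodFin-* : ∀ k (f g : Fin k → ℕ) → prodFin k (λ i → f i * g i) ≡ prodFin k f * prodFin k g
prodFin-* zero f g = refl
prodFin-* (suc k) f g = trans (cong (f zero * g zero *_) (prodFin-* k (λ i → f (suc i)) (λ i → g (suc i))))
  (*-interchange (f zero) (g zero) _ _)

prodFin-≡⇒≗ : ∀ k {f g : Fin k → ℕ} → (∀ i → f i ≤ g i) → (∀ i → 0 < g i) →
  prodFin k f ≡ prodFin k g → ∀ i → f i ≡ g i
prodFin-≡⇒≗ (suc k) {f} {g} f≤g pos eq = pointwise
  where
  rest≤ : prodFin k (λ i → f (suc i)) ≤ prodFin k (λ i → g (suc i))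
  rest≤ = prodFin-mono k (λ i → f≤g (suc i))
  head≡ : f zero ≡ g zero
  head≡ with m≤n⇒m<n∨m≡n (f≤g zero)
  ... | inj₂ eq₀ = eq₀
  ... | inj₁ lt = contradiction eq (<⇒≢ (≤-<-trans (*-monoʳ-≤ (f zero) rest≤)
          (*-monoˡ-< _ {{>-nonZero (prodFin-pos k (λ i → pos (suc i)))}} lt)))
  rest≡ : prodFin k (λ i → f (suc i)) ≡ prodFin k (λ i → g (suc i))
  rest≡ = *-cancelˡ-≡ _ _ (g zero) {{>-nonZero (pos zero)}} (trans (cong (_* _) (sym head≡)) eq)
  pointwise : ∀ i → f i ≡ g i
  pointwise zero = head≡
  pointwise (suc i) = prodFin-≡⇒≗ k (λ j → f≤g (suc j)) (λ j → pos (suc j)) rest≡ i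

rotate : ∀ {k} → Fin (suc k) → Fin (suc k)
rotate {k} zero = fromℕ k
rotate (suc i) = inject₁ i

rotate-≢ : ∀ {k} (i : Fin (suc (suc k))) → i ≢ rotate i
rotate-≢ zero ()
rotate-≢ (suc i) eq = <-irrefl (trans (sym (toℕ-inject₁ i)) (sym (cong toℕ eq))) (n<1+n (toℕ i))

prodFin-last : ∀ k (f : Fin (suc k) → ℕ) →
  prodFin (suc k) f ≡ prodFin k (λ i → f (inject₁ i)) * f (fromℕ k)
prodFin-last zero f = *-comm (f zero) 1
prodFin-last (suc k) f = trans (cong (f zero *_) (prodFin-last k (λ i → f (suc i))))
  (sym (*-assoc (f zero) _ _))

prodFin-rotate : ∀ k (f : Fin (suc k) → ℕ) → prodFin (suc k) (λ i → f (rotate i)) ≡ prodFin (suc k) f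
prodFin-rotate k f = trans (*-comm (f (fromℕ k)) _) (sym (prodFin-last k f))

prodFin-*rotate : ∀ k (f : Fin (suc k) → ℕ) →
  prodFin (suc k) (λ i → f i * f (rotate i)) ≡ prodFin (suc k) f * prodFin (suc k) f
prodFin-*rotate k f =
  trans (prodFin-* (suc k) f (λ i → f (rotate i))) (cong (prodFin (suc k) f *_) (prodFin-rotate k f))

prodFin-≤-by-pairs : ∀ k {f g : Fin (suc k) → ℕ} → (∀ i → f i * f (rotate i) ≤ g i * g (rotate i)) →
  prodFin (suc k) f ≤ prodFin (suc k) g
prodFin-≤-by-pairs k {f} {g} pairs = *-self-≤⁻ (subst₂ _≤_ (prodFin-*rotate k f) (prodFin-*rotate k g)
  (prodFin-mono (suc k) pairs))
  where
  *-self-≤⁻ : ∀ {a b} → a * a ≤ b * b → a ≤ b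
  *-self-≤⁻ {a} {b} sq with a ≤? b
  ... | yes a≤b = a≤b
  ... | no a≰b = contradiction sq (<⇒≱ (*-mono-< (≰⇒> a≰b) (≰⇒> a≰b)))

prodFin-≡-by-pairs : ∀ k {f g : Fin (suc k) → ℕ} → (∀ i → f i * f (rotate i) ≤ g i * g (rotate i)) →
  (∀ i → 0 < g i) → prodFin (suc k) f ≡ prodFin (suc k) g →
  ∀ i → f i * f (rotate i) ≡ g i * g (rotate i)
prodFin-≡-by-pairs k {f} {g} pairs pos eq =
  prodFin-≡⇒≗ (suc k) pairs (λ i → *-mono-< (pos i) (pos (rotate i)))
  (trans (prodFin-*rotate k f) (trans (cong₂ _*_ eq eq) (sym (prodFin-*rotate k g))))

∀Fin-or-counterexample : ∀ k {P Q : Fin k → Set} → (∀ i → P i ⊎ Q i) → (∀ i → P i) ⊎ Σ (Fin k) Q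
∀Fin-or-counterexample zero _ = inj₁ λ ()
∀Fin-or-counterexample (suc k) decide with decide zero | ∀Fin-or-counterexample k (λ i → decide (suc i))
... | inj₂ q | _ = inj₂ (zero , q)
... | inj₁ _ | inj₂ (i , q) = inj₂ (suc i , q)
... | inj₁ p | inj₁ ps = inj₁ λ { zero → p ; (suc i) → ps i }

module CrossIntersectingFamilies {m t c : ℕ} (n r : Fin (suc (suc m)) → ℕ) (A : ∀ i → Family (n i))
  (uniform : ∀ i → Uniform (r i) (A i))
  (cross : ∀ i j → i ≢ j → CrossIntersecting t (A i) (A j))
  (t≤r : ∀ i → t ≤ r i) (large : ∀ i → (r i ∸ t) * c + t ≤ n i)
  (c-large : ∀ i j → i ≢ j → r i * binom (r j) t < c) where

  k : ℕ
  k = suc (suc m)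

  cards : Fin k → ℕ
  cards i = card (A i)

  starSize : Fin k → ℕ
  starSize i = binom (n i ∸ t) (r i ∸ t)

  starSize-pos : ∀ i → 0 < starSize i
  starSize-pos i = binom-pos-large {r = r i} {t} (≤-<-trans z≤n (c-large zero (suc zero) λ ())) (large i)

  t<c : t < c
  t<c = ≤-<-trans (≤-trans (t≤r zero) (m≤m*n (r zero) (binom (r (suc zero)) t)
          {{>-nonZero (binom-pos (r (suc zero)) t (t≤r (suc zero)))}}))
        (c-large zero (suc zero) λ ())

  Nonempty : Set
  Nonempty = ∀ i → Σ (Subset (n i)) λ S → A i S ≡ true

  nonempty⊎empty : Nonempty ⊎ Σ (Fin k) λ i → card (A i) ≡ 0
  nonempty⊎empty = ∀Fin-or-counterexample k (λ i → swap (card≡0⊎member (A i)))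

  pair : Nonempty → ∀ i j → i ≢ j →
    card (A i) * card (A j) < starSize i * starSize j ⊎ CommonCentre t (A i) (A j)
  pair nonempty i j i≢j = pair-bound (uniform i) (uniform j) (cross i j i≢j) (t≤r i) (t≤r j)
    (large i) (large j) (c-large i j i≢j) (c-large j i λ j≡i → i≢j (sym j≡i))
    _ (proj₂ (nonempty i)) _ (proj₂ (nonempty j))

  pair-≤ : Nonempty → ∀ i j → i ≢ j → card (A i) * card (A j) ≤ starSize i * starSize j
  pair-≤ nonempty i j i≢j with pair nonempty i j i≢j
  ... | inj₁ lt = <⇒≤ lt
  ... | inj₂ ((_ , T) , ∣T∣≡t , T⊆⋂Ai , T⊆⋂Aj) =
    *-mono-≤ (⊆⋂⇒card≤ T ∣T∣≡t (t≤r i) (uniform i) T⊆⋂Ai)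
             (⊆⋂⇒card≤ T ∣T∣≡t (t≤r j) (uniform j) T⊆⋂Aj)

  product-bound : prodFin k cards ≤ prodFin k starSize
  product-bound with nonempty⊎empty
  ... | inj₂ (i , empty) = subst (_≤ prodFin k starSize) (sym (prodFin-zero k {cards} i empty)) z≤n
  ... | inj₁ nonempty =
    prodFin-≤-by-pairs (suc m) {cards} {starSize} (λ i → pair-≤ nonempty i (rotate i) (rotate-≢ i))

  equality-case : prodFin k cards ≡ prodFin k starSize →
    (Σ FinSet λ T → size T ≡ t × ∀ i → proj₂ T ⊆⋂ A i) × (∀ i → card (A i) ≡ starSize i)
  equality-case eq with nonempty⊎empty
  ... | inj₂ (i , empty) =
    contradiction (trans (sym (prodFin-zero k {cards} i empty)) eq) (<⇒≢ (prodFin-pos k starSize-pos))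
  ... | inj₁ nonempty = common (centre₀ (suc zero) (λ ())) , card≡
    where
    centreOf : ∀ i j → i ≢ j → card (A i) * card (A j) ≡ starSize i * starSize j →
      CommonCentre t (A i) (A j)
    centreOf i j i≢j tight with pair nonempty i j i≢j
    ... | inj₁ lt = contradiction tight (<⇒≢ lt)
    ... | inj₂ centre = centre
    tight : ∀ i → card (A i) * card (A (rotate i)) ≡ starSize i * starSize (rotate i)
    tight = prodFin-≡-by-pairs (suc m) {cards} {starSize}
      (λ i → pair-≤ nonempty i (rotate i) (rotate-≢ i)) starSize-pos eq
    card≤ : ∀ i → card (A i) ≤ starSize i
    card≤ i with centreOf i (rotate i) (rotate-≢ i) (tight i)
    ... | (_ , T) , ∣T∣≡t , T⊆⋂Ai , _ = ⊆⋂⇒card≤ T ∣T∣≡t (t≤r i) (uniform i) T⊆⋂Ai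
    card≡ : ∀ i → card (A i) ≡ starSize i
    card≡ = prodFin-≡⇒≗ k {cards} {starSize} card≤ starSize-pos eq
    centre₀ : ∀ j → zero ≢ j → CommonCentre t (A zero) (A j)
    centre₀ j 0≢j = centreOf zero j 0≢j (cong₂ _*_ (card≡ zero) (card≡ j))
    common : CommonCentre t (A zero) (A (suc zero)) →
      Σ FinSet λ T → size T ≡ t × ∀ i → proj₂ T ⊆⋂ A i
    common ((a , T*) , ∣T*∣≡t , T*⊆⋂A₀ , _) = (a , T*) , ∣T*∣≡t , T*⊆⋂A
      where
      T*⊆⋂A : ∀ i → T* ⊆⋂ A i
      T*⊆⋂A zero = T*⊆⋂A₀
      T*⊆⋂A (suc j) S S∈A with centre₀ (suc j) (λ ())
      ... | (_ , T) , ∣T∣≡t , T⊆⋂A₀ , T⊆⋂Aj =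
        ⊆-trans T* T S (centre-unique T* T t<c (t≤r zero) (large zero) (uniform zero) (card≡ zero)
                          ∣T*∣≡t ∣T∣≡t T*⊆⋂A₀ T⊆⋂A₀)
          (T⊆⋂Aj S S∈A)

-- The constant c(r_{k-1}, r_k, t)

*binom<cfun : ∀ {x y t a b} → t ≤ x ⊓ y → (a ≤ x × b ≤ y) ⊎ (a ≤ y × b ≤ x) →
  a * binom b t < cfun x y t
*binom<cfun {x} {y} {t} {a} {b} t≤x⊓y ordered with t ≤? x ⊓ y
... | no t≰x⊓y = contradiction t≤x⊓y t≰x⊓y
... | yes _ = s≤s (subst (a * binom b t ≤_)
                    (cong₂ _⊔_ (cong (x *_) (binom≡C y t)) (cong (y *_) (binom≡C x t))) (bound ordered))
  where
  bound : (a ≤ x × b ≤ y) ⊎ (a ≤ y × b ≤ x) → a * binom b t ≤ x * binom y t ⊔ y * binom x t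
  bound (inj₁ (a≤x , b≤y)) = ≤-trans (*-mono-≤ a≤x (binom-monoˡ t b≤y)) (m≤m⊔n _ _)
  bound (inj₂ (a≤y , b≤x)) = ≤-trans (*-mono-≤ a≤y (binom-monoˡ t b≤x)) (m≤n⊔m _ _)

last⊎≤penultimate : ∀ m (i : Fin (suc (suc m))) →
  i ≡ fromℕ (suc m) ⊎ i Data.Fin.≤ inject₁ (fromℕ m)
last⊎≤penultimate zero zero = inj₂ z≤n
last⊎≤penultimate zero (suc zero) = inj₁ refl
last⊎≤penultimate (suc m) zero = inj₂ z≤n
last⊎≤penultimate (suc m) (suc i) with last⊎≤penultimate m i
... | inj₁ i≡last = inj₁ (cong suc i≡last)
... | inj₂ i≤pen = inj₂ (s≤s i≤pen)

sorted⇒cfun-large : ∀ m t (r : Fin (suc (suc m)) → ℕ) → (∀ i j → i Data.Fin.≤ j → r i ≤ r j) →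
  (∀ i → t ≤ r i) → ∀ i j → i ≢ j →
  r i * binom (r j) t < cfun (r (inject₁ (fromℕ m))) (r (fromℕ (suc m))) t
sorted⇒cfun-large m t r sorted t≤r i j i≢j =
  *binom<cfun (⊓-glb (t≤r penultimate) (t≤r last))
    (ordered (last⊎≤penultimate m i) (last⊎≤penultimate m j))
  where
  penultimate = inject₁ (fromℕ m)
  last = fromℕ (suc m)
  ordered : i ≡ last ⊎ i Data.Fin.≤ penultimate → j ≡ last ⊎ j Data.Fin.≤ penultimate →
    (r i ≤ r penultimate × r j ≤ r last) ⊎ (r i ≤ r last × r j ≤ r penultimate)
  ordered (inj₁ refl) (inj₁ refl) = contradiction refl i≢j
  ordered (inj₁ refl) (inj₂ j≤pen) = inj₂ (≤-refl , sorted j penultimate j≤pen)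
  ordered (inj₂ i≤pen) _ = inj₁ (sorted i penultimate i≤pen , sorted j last (≤fromℕ j))

theorem4p1 : (m : ℕ) (t : ℕ) (r n : Fin (suc (suc m)) → ℕ) →
    1 Data.Nat.≤ t → t Data.Nat.≤ r zero →
    (∀ i j → i Data.Fin.≤ j → r i Data.Nat.≤ r j) →
    (∀ i → (r i ∸ t) * cfun (r (inject₁ (fromℕ m))) (r (fromℕ (suc m))) t + t Data.Nat.≤ n i) →
    ExtrastrongCrossStar n t (λ i → binomFam (n i) (r i))
theorem4p1 m t r n _ t≤r₀ sorted large = (t , ⊤) , ∣⊤∣≡n t , λ A cross below →
  let open CrossIntersectingFamilies n r A (λ i S S∈A → binomFam⇒∣∣≡ S (below i S S∈A)) cross t≤r large
             (sorted⇒cfun-large m t r sorted t≤r)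
      starSizes = prodFin-cong k λ i →
        card-star-binomFam (⊤ {t}) ⊤ (⊤⊆⊤ (≤-trans (m≤n+m t _) (large i))) (∣⊤∣≡n t) (t≤r i)
  in subst (prodFin k cards ≤_) (sym starSizes) product-bound ,
     λ eq → let ((a , T) , ∣T∣≡t , T⊆⋂A) , card≡ = equality-case (trans eq starSizes)
            in (a , T) , ∣T∣≡t ,
               λ i → ⊆star∧card≡⇒≡star T ∣T∣≡t (t≤r i) (below i) (T⊆⋂A i) (card≡ i)
  where
  t≤r : ∀ i → t ≤ r i
  t≤r i = ≤-trans t≤r₀ (sorted zero i z≤n)
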